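{- Let $n=4k+r$ with integers $k\ge0$ and $0\le r<4$, and let $t_n(1,-1)=\sum_{\pi}(-1)^{\sigma_2(\pi)}$, the sum over all involutions $\pi$ of $[n]$, where $\sigma_2(\pi)$ is the number of 2-cycles of $\pi$. Then $${\rm ord}_2(t_n(1,-1))=\begin{cases}k+\lfloor r/2\rfloor,&\text{if } r\ne2,\\ k+3+{\rm ord}_2(k),&\text{if } r=2.\end{cases}$$
   Context: ${\rm ord}_2(m)$ denotes the largest integer $e$ with $2^e\mid m$, with the convention ${\rm ord}_2(0)=+\infty$. An involution of $[n]$ is a permutation $\pi$ with $\pi^2=1$. -}

module Defs where

open import Data.Nat using (ℕ; zero; suc; _+_; _^_; _≤_; _<?_)
open import Data.Integer as ℤ using (ℤ; +_; -1ℤ)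
open import Data.Integer.Divisibility using () renaming (_∣_ to _∣ℤ_)
open import Data.Fin using (Fin; toℕ)
open import Data.Fin.Properties using (all?)
open import Data.Vec using (Vec; []; _∷_; lookup)
open import Data.List using (List; []; _∷_; [_]; map; concatMap; filter; foldr; length)
open import Data.List.Base using (allFin)
open import Relation.Binary.PropositionalEquality using (_≡_)
open import Relation.Nullary.Decidable using (does)
open import Data.Fin.Properties using (_≟_)
open import Data.Product using (_×_)
open import Relation.Nullary using (Dec)

allMaps : (n m : ℕ) → List (Vec (Fin m) n)
allMaps zero    m = [ [] ]
allMaps (suc n) m = concatMap (λ v → map (_∷ v) (allFin m)) (allMaps n m)

-- π is an involution: π ∘ π = id  (such a map is automatically a permutation)
IsInvolution : {n : ℕ} → Vec (Fin n) n → Set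
IsInvolution {n} π = (i : Fin n) → lookup π (lookup π i) ≡ i

isInvolution? : {n : ℕ} (π : Vec (Fin n) n) → Dec (IsInvolution π)
isInvolution? π = all? (λ i → lookup π (lookup π i) ≟ i)

involutions : (n : ℕ) → List (Vec (Fin n) n)
involutions n = filter isInvolution? (allMaps n n)

-- number of 2-cycles of an involution π: each 2-cycle (i j) with i < j is
-- counted exactly once, via its smaller element i (i.e. toℕ i < toℕ (π i)).
σ₂ : {n : ℕ} → Vec (Fin n) n → ℕ
σ₂ {n} π = length (filter (λ i → toℕ i <? toℕ (lookup π i)) (allFin n))

t : ℕ → ℤ
t n = foldr ℤ._+_ (+ 0) (map (λ π → -1ℤ ℤ.^ σ₂ π) (involutions n))

data ℕ∞ : Set where
  fin : ℕ → ℕ∞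
  ∞   : ℕ∞

_+∞_ : ℕ∞ → ℕ∞ → ℕ∞
fin a +∞ fin b = fin (a + b)
fin _ +∞ ∞     = ∞
∞     +∞ _     = ∞

Ord₂ : ℤ → ℕ∞ → Set
Ord₂ m (fin e) = (+ (2 ^ e) ∣ℤ m) × ((f : ℕ) → + (2 ^ f) ∣ℤ m → f ≤ e)
Ord₂ m ∞       = m ≡ + 0

-- Deleting the point 0 splits the involutions of [n+2] into those fixing 0, which are the
-- involutions of [n+1], and those exchanging 0 with one of the other n+1 points, each such
-- family being in sign-reversing bijection with the involutions of [n]; hence
-- t(n+2) = t(n+1) - (n+1) t(n). Running this recurrence through one period of four from the
-- form t(4k) = 2^k X, t(4k+2) = 2^k 8k Y with X, Y odd reproduces the same form at k+1 and
-- shows t(4k+1) and t(4k+3) to be 2^k and 2^(k+1) times odd numbers. For r = 2 the factor k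
-- contributes its own ord₂(k).
module Submission where

open import Data.Bool using (true; false; if_then_else_)
open import Data.Empty using (⊥-elim)
open import Data.Fin as Fin using (Fin; zero; suc; toℕ; punchIn; punchOut)
import Data.Fin.Properties as Fin
open import Data.Integer as ℤ using (ℤ; +_; -_; _+_; _-_; _*_; -1ℤ; ∣_∣)
import Data.Integer.Properties as ℤ
open import Data.Integer.Divisibility using () renaming (_∣_ to _∣ℤ_)
import Data.Integer.Divisibility.Signed as Signed
open import Data.Integer.Tactic.RingSolver using (solve-∀)
open import Data.List using (List; []; _∷_; _++_; map; foldr; filter; concatMap; length; allFin)
import Data.List.Properties as List
open import Data.Nat as ℕ using (ℕ; _^_; _≤_; _≤?_; _<?_; s≤s)
import Data.Nat.Properties as ℕ
open import Data.Nat.Divisibility as ℕ using (_∣_; divides)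
import Data.Nat.Tactic.RingSolver as ℕ-Solver
open import Data.Product using (∃-syntax; _×_; _,_)
open import Data.Vec as Vec using (Vec; _∷_; lookup; insertAt)
import Data.Vec.Properties as Vec
open import Function using (_∘_; id; _⇔_; mk⇔; Equivalence)
open import Relation.Nullary using (Dec; yes; no; does; ¬_)
open import Relation.Nullary.Decidable using (does-⇔; dec-false)
open import Relation.Unary using (Decidable)
open import Relation.Binary.PropositionalEquality
open ≡-Reasoning

open import Defs

-- Finite sums and the enumeration of maps

∑ : {A : Set} → List A → (A → ℤ) → ℤ
∑ xs f = foldr _+_ (+ 0) (map f xs)

infix 7 ∑
syntax ∑ xs (λ x → e) = ∑[ x ∈ xs ] e

module _ {A : Set} where

  ∑-cong : (xs : List A) {f g : A → ℤ} → (∀ x → f x ≡ g x) → ∑ xs f ≡ ∑ xs g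
  ∑-cong []       f≗g = refl
  ∑-cong (x ∷ xs) f≗g = cong₂ _+_ (f≗g x) (∑-cong xs f≗g)

  ∑-++ : (xs ys : List A) (f : A → ℤ) → ∑ (xs ++ ys) f ≡ ∑ xs f + ∑ ys f
  ∑-++ []       ys f = sym (ℤ.+-identityˡ _)
  ∑-++ (x ∷ xs) ys f = trans (cong (_+_ (f x)) (∑-++ xs ys f)) (sym (ℤ.+-assoc (f x) _ _))

  ∑-zero : (xs : List A) → ∑[ _ ∈ xs ] + 0 ≡ + 0
  ∑-zero []       = refl
  ∑-zero (x ∷ xs) = trans (ℤ.+-identityˡ _) (∑-zero xs)

  ∑-+ : (xs : List A) (f g : A → ℤ) → ∑[ x ∈ xs ] (f x + g x) ≡ ∑ xs f + ∑ xs g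
  ∑-+ []       f g = refl
  ∑-+ (x ∷ xs) f g = trans (cong (_+_ (f x + g x)) (∑-+ xs f g)) (interchange (f x) (g x) _ _)
    where
    interchange : ∀ a b c d → a + b + (c + d) ≡ a + c + (b + d)
    interchange = solve-∀

  ∑-neg : (xs : List A) (f : A → ℤ) → ∑[ x ∈ xs ] - f x ≡ - ∑ xs f
  ∑-neg []       f = refl
  ∑-neg (x ∷ xs) f = trans (cong (_+_ (- f x)) (∑-neg xs f)) (sym (ℤ.neg-distrib-+ (f x) _))

  ∑-const : (xs : List A) (c : ℤ) → ∑[ _ ∈ xs ] c ≡ + length xs * c
  ∑-const []       c = refl
  ∑-const (x ∷ xs) c = trans (cong (_+_ c) (∑-const xs c)) (sym (ℤ.suc-* (+ length xs) c))

  ∑-map : {B : Set} (g : B → A) (xs : List B) (f : A → ℤ) → ∑ (map g xs) f ≡ ∑ xs (f ∘ g)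
  ∑-map g []       f = refl
  ∑-map g (x ∷ xs) f = cong (_+_ (f (g x))) (∑-map g xs f)

  ∑-concatMap : {B : Set} (h : B → List A) (xs : List B) (f : A → ℤ) →
                ∑ (concatMap h xs) f ≡ ∑[ x ∈ xs ] ∑ (h x) f
  ∑-concatMap h []       f = refl
  ∑-concatMap h (x ∷ xs) f = trans (∑-++ (h x) _ f) (cong (_+_ (∑ (h x) f)) (∑-concatMap h xs f))

  ∑-filter : {P : A → Set} (P? : Decidable P) (xs : List A) (f : A → ℤ) →
             ∑ (filter P? xs) f ≡ ∑[ x ∈ xs ] (if does (P? x) then f x else + 0)
  ∑-filter P? []       f = refl
  ∑-filter P? (x ∷ xs) f with does (P? x)
  ... | true  = cong (_+_ (f x)) (∑-filter P? xs f)
  ... | false = trans (∑-filter P? xs f) (sym (ℤ.+-identityˡ _))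

∑-swap : {A B : Set} (xs : List A) (ys : List B) (f : A → B → ℤ) →
         ∑[ x ∈ xs ] ∑ ys (f x) ≡ ∑[ y ∈ ys ] ∑[ x ∈ xs ] f x y
∑-swap []       ys f = sym (∑-zero ys)
∑-swap (x ∷ xs) ys f = trans (cong (_+_ (∑ ys (f x))) (∑-swap xs ys f)) (sym (∑-+ ys (f x) _))

∑-allFin-suc : (m : ℕ) (f : Fin (ℕ.suc m) → ℤ) →
               ∑ (allFin (ℕ.suc m)) f ≡ f zero + ∑[ i ∈ allFin m ] f (suc i)
∑-allFin-suc m f =
  cong (_+_ (f zero)) (trans (cong (λ is → ∑ is f) (sym (List.map-tabulate id suc))) (∑-map suc (allFin m) f))

∑-allFin-punchIn : (m : ℕ) (j : Fin (ℕ.suc m)) (f : Fin (ℕ.suc m) → ℤ) →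
                   ∑ (allFin (ℕ.suc m)) f ≡ f j + ∑[ i ∈ allFin m ] f (punchIn j i)
∑-allFin-punchIn m           zero    f = ∑-allFin-suc m f
∑-allFin-punchIn (ℕ.suc m) (suc j) f = begin
  ∑ (allFin (ℕ.suc (ℕ.suc m))) f
    ≡⟨ ∑-allFin-suc (ℕ.suc m) f ⟩
  f zero + ∑[ i ∈ allFin (ℕ.suc m) ] f (suc i)
    ≡⟨ cong (_+_ (f zero)) (∑-allFin-punchIn m j (f ∘ suc)) ⟩
  f zero + (f (suc j) + ∑[ i ∈ allFin m ] f (suc (punchIn j i)))
    ≡⟨ left-comm (f zero) (f (suc j)) _ ⟩
  f (suc j) + (f zero + ∑[ i ∈ allFin m ] f (suc (punchIn j i)))
    ≡⟨ cong (_+_ (f (suc j))) (sym (∑-allFin-suc m (f ∘ punchIn (suc j)))) ⟩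
  f (suc j) + ∑[ i ∈ allFin (ℕ.suc m) ] f (punchIn (suc j) i)
    ∎
  where
  left-comm : ∀ a b c → a + (b + c) ≡ b + (a + c)
  left-comm = solve-∀

∑-allFin-const : (m : ℕ) (c : ℤ) → ∑[ _ ∈ allFin m ] c ≡ + m * c
∑-allFin-const m c = trans (∑-const (allFin m) c) (cong (λ l → + l * c) (List.length-tabulate {n = m} id))

∑-allMaps-suc : (n m : ℕ) (f : Vec (Fin m) (ℕ.suc n) → ℤ) →
                ∑ (allMaps (ℕ.suc n) m) f ≡ ∑[ v ∈ allMaps n m ] ∑[ a ∈ allFin m ] f (a ∷ v)
∑-allMaps-suc n m f =
  trans (∑-concatMap _ (allMaps n m) f) (∑-cong (allMaps n m) (λ v → ∑-map (_∷ v) (allFin m) f))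

∑-allMaps-head : (n m : ℕ) (f : Vec (Fin m) (ℕ.suc n) → ℤ) →
                 ∑ (allMaps (ℕ.suc n) m) f ≡ ∑[ a ∈ allFin m ] ∑[ v ∈ allMaps n m ] f (a ∷ v)
∑-allMaps-head n m f = trans (∑-allMaps-suc n m f) (∑-swap (allMaps n m) (allFin m) _)

∑-allMaps-insertAt : (n m : ℕ) (j : Fin (ℕ.suc n)) (f : Vec (Fin m) (ℕ.suc n) → ℤ) →
                     ∑ (allMaps (ℕ.suc n) m) f ≡ ∑[ b ∈ allFin m ] ∑[ u ∈ allMaps n m ] f (insertAt u j b)
∑-allMaps-insertAt n           m zero    f = ∑-allMaps-head n m f
∑-allMaps-insertAt (ℕ.suc n) m (suc j) f = begin
  ∑ (allMaps (ℕ.suc (ℕ.suc n)) m) f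
    ≡⟨ ∑-allMaps-head (ℕ.suc n) m f ⟩
  ∑[ a ∈ allFin m ] ∑[ v ∈ allMaps (ℕ.suc n) m ] f (a ∷ v)
    ≡⟨ ∑-cong (allFin m) (λ a → ∑-allMaps-insertAt n m j (λ v → f (a ∷ v))) ⟩
  ∑[ a ∈ allFin m ] ∑[ b ∈ allFin m ] ∑[ u ∈ allMaps n m ] f (a ∷ insertAt u j b)
    ≡⟨ ∑-swap (allFin m) (allFin m) _ ⟩
  ∑[ b ∈ allFin m ] ∑[ a ∈ allFin m ] ∑[ u ∈ allMaps n m ] f (a ∷ insertAt u j b)
    ≡⟨ ∑-cong (allFin m) (λ b → sym (∑-allMaps-head n m (λ u → f (insertAt u (suc j) b)))) ⟩
  ∑[ b ∈ allFin m ] ∑[ u ∈ allMaps (ℕ.suc n) m ] f (insertAt u (suc j) b)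
    ∎

∑-allMaps-punchIn : (n m : ℕ) (p : Fin (ℕ.suc m)) (f : Vec (Fin (ℕ.suc m)) n → ℤ) →
                    (∀ v i → Vec.lookup v i ≡ p → f v ≡ + 0) →
                    ∑ (allMaps n (ℕ.suc m)) f ≡ ∑[ u ∈ allMaps n m ] f (Vec.map (punchIn p) u)
∑-allMaps-punchIn ℕ.zero    m p f f-vanishes = refl
∑-allMaps-punchIn (ℕ.suc n) m p f f-vanishes = begin
  ∑ (allMaps (ℕ.suc n) (ℕ.suc m)) f
    ≡⟨ ∑-allMaps-suc n (ℕ.suc m) f ⟩
  ∑[ v ∈ allMaps n (ℕ.suc m) ] ∑[ a ∈ allFin (ℕ.suc m) ] f (a ∷ v)
    ≡⟨ ∑-cong (allMaps n (ℕ.suc m)) drop-p ⟩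
  ∑[ v ∈ allMaps n (ℕ.suc m) ] ∑[ a ∈ allFin m ] f (punchIn p a ∷ v)
    ≡⟨ ∑-swap (allMaps n (ℕ.suc m)) (allFin m) _ ⟩
  ∑[ a ∈ allFin m ] ∑[ v ∈ allMaps n (ℕ.suc m) ] f (punchIn p a ∷ v)
    ≡⟨ ∑-cong (allFin m) (λ a → ∑-allMaps-punchIn n m p (λ v → f (punchIn p a ∷ v))
                                  (λ v i → f-vanishes (punchIn p a ∷ v) (suc i))) ⟩
  ∑[ a ∈ allFin m ] ∑[ u ∈ allMaps n m ] f (punchIn p a ∷ Vec.map (punchIn p) u)
    ≡⟨ sym (∑-allMaps-head n m (λ u → f (Vec.map (punchIn p) u))) ⟩
  ∑[ u ∈ allMaps (ℕ.suc n) m ] f (Vec.map (punchIn p) u)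
    ∎
  where
  drop-p : ∀ v → ∑[ a ∈ allFin (ℕ.suc m) ] f (a ∷ v) ≡ ∑[ a ∈ allFin m ] f (punchIn p a ∷ v)
  drop-p v = begin
    ∑[ a ∈ allFin (ℕ.suc m) ] f (a ∷ v)                  ≡⟨ ∑-allFin-punchIn m p (λ a → f (a ∷ v)) ⟩
    f (p ∷ v) + ∑[ a ∈ allFin m ] f (punchIn p a ∷ v)   ≡⟨ cong (_+ rest) (f-vanishes (p ∷ v) zero refl) ⟩
    + 0 + ∑[ a ∈ allFin m ] f (punchIn p a ∷ v)         ≡⟨ ℤ.+-identityˡ _ ⟩
    ∑[ a ∈ allFin m ] f (punchIn p a ∷ v)               ∎
    where rest = ∑[ a ∈ allFin m ] f (punchIn p a ∷ v)

-- Involutions and their signs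

indicator : {P : Set} → Dec P → ℤ
indicator P? = if does P? then + 1 else + 0

indicator-⇔ : {P Q : Set} → P ⇔ Q → (P? : Dec P) (Q? : Dec Q) → indicator P? ≡ indicator Q?
indicator-⇔ P⇔Q P? Q? = cong (λ b → if b then + 1 else + 0) (does-⇔ P⇔Q P? Q?)

length-filter-as-∑ : {A : Set} {P : A → Set} (P? : Decidable P) (xs : List A) →
                     + length (filter P? xs) ≡ ∑[ x ∈ xs ] indicator (P? x)
length-filter-as-∑ P? xs = begin
  + length (filter P? xs)             ≡⟨ ℤ.*-identityʳ _ ⟨
  + length (filter P? xs) * + 1       ≡⟨ ∑-const (filter P? xs) (+ 1) ⟨
  ∑[ _ ∈ filter P? xs ] + 1           ≡⟨ ∑-filter P? xs (λ _ → + 1) ⟩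
  ∑[ x ∈ xs ] indicator (P? x)        ∎

σ₂-as-∑ : {n : ℕ} (π : Vec (Fin n) n) →
          + σ₂ π ≡ ∑[ i ∈ allFin n ] indicator (toℕ i <? toℕ (lookup π i))
σ₂-as-∑ {n} π = length-filter-as-∑ (λ i → toℕ i <? toℕ (lookup π i)) (allFin n)

weight : {n : ℕ} → Vec (Fin n) n → ℤ
weight π = if does (isInvolution? π) then -1ℤ ℤ.^ σ₂ π else + 0

t≡∑weight : (n : ℕ) → t n ≡ ∑ (allMaps n n) weight
t≡∑weight n = ∑-filter isInvolution? (allMaps n n) (λ π → -1ℤ ℤ.^ σ₂ π)

module _ {n : ℕ} {π : Vec (Fin n) n} where

  involution-injective : IsInvolution π → {i j : Fin n} → lookup π i ≡ lookup π j → i ≡ j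
  involution-injective inv {i} {j} πi≡πj = trans (sym (inv i)) (trans (cong (lookup π) πi≡πj) (inv j))

  weight-nonInvolution : ¬ IsInvolution π → weight π ≡ + 0
  weight-nonInvolution ¬inv = cong (λ b → if b then -1ℤ ℤ.^ σ₂ π else + 0) (dec-false (isInvolution? π) ¬inv)

  weight-collision : {i j : Fin n} → lookup π i ≡ lookup π j → i ≢ j → weight π ≡ + 0
  weight-collision πi≡πj i≢j = weight-nonInvolution (λ inv → i≢j (involution-injective inv πi≡πj))

  weight-transfer : {m : ℕ} {u : Vec (Fin m) m} → IsInvolution π ⇔ IsInvolution u →
                    (d : ℕ) → σ₂ π ≡ d ℕ.+ σ₂ u → weight π ≡ -1ℤ ℤ.^ d * weight u
  weight-transfer {u = u} π⇔u d σ₂π≡d+σ₂u = by-cases (isInvolution? π) (isInvolution? u)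
    where
    by-cases : (π? : Dec (IsInvolution π)) (u? : Dec (IsInvolution u)) →
               (if does π? then -1ℤ ℤ.^ σ₂ π else + 0)
               ≡ -1ℤ ℤ.^ d * (if does u? then -1ℤ ℤ.^ σ₂ u else + 0)
    by-cases (yes _)   (yes _)    = trans (cong (-1ℤ ℤ.^_) σ₂π≡d+σ₂u) (ℤ.^-distribˡ-+-* -1ℤ d (σ₂ u))
    by-cases (no _)    (no _)     = sym (ℤ.*-zeroʳ (-1ℤ ℤ.^ d))
    by-cases (yes inv) (no ¬inv)  = ⊥-elim (¬inv (Equivalence.to π⇔u inv))
    by-cases (no ¬inv) (yes inv)  = ⊥-elim (¬inv (Equivalence.from π⇔u inv))

extendFix : {n : ℕ} → Vec (Fin n) n → Vec (Fin (ℕ.suc n)) (ℕ.suc n)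
extendFix u = zero ∷ Vec.map suc u

module _ {n : ℕ} (u : Vec (Fin n) n) where

  private
    π = extendFix u

    lookup-extendFix : (i : Fin n) → lookup π (suc i) ≡ suc (lookup u i)
    lookup-extendFix i = Vec.lookup-map i suc u

  extendFix-involution : IsInvolution π ⇔ IsInvolution u
  extendFix-involution = mk⇔ to from
    where
    to : IsInvolution π → IsInvolution u
    to inv i = Fin.suc-injective (begin
      suc (lookup u (lookup u i))  ≡⟨ lookup-extendFix (lookup u i) ⟨
      lookup π (suc (lookup u i))  ≡⟨ cong (lookup π) (lookup-extendFix i) ⟨
      lookup π (lookup π (suc i))  ≡⟨ inv (suc i) ⟩
      suc i                        ∎)
    from : IsInvolution u → IsInvolution π
    from inv zero    = refl
    from inv (suc i) = begin
      lookup π (lookup π (suc i))  ≡⟨ cong (lookup π) (lookup-extendFix i) ⟩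
      lookup π (suc (lookup u i))  ≡⟨ lookup-extendFix (lookup u i) ⟩
      suc (lookup u (lookup u i))  ≡⟨ cong suc (inv i) ⟩
      suc i                        ∎

  σ₂-extendFix : σ₂ π ≡ σ₂ u
  σ₂-extendFix = ℤ.+-injective (begin
    + σ₂ π
      ≡⟨ σ₂-as-∑ π ⟩
    ∑[ i ∈ allFin (ℕ.suc n) ] indicator (toℕ i <? toℕ (lookup π i))
      ≡⟨ ∑-allFin-suc n (λ i → indicator (toℕ i <? toℕ (lookup π i))) ⟩
    + 0 + ∑[ i ∈ allFin n ] indicator (toℕ (suc i) <? toℕ (lookup π (suc i)))
      ≡⟨ ℤ.+-identityˡ _ ⟩
    ∑[ i ∈ allFin n ] indicator (toℕ (suc i) <? toℕ (lookup π (suc i)))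
      ≡⟨ ∑-cong (allFin n) (λ i → cong (λ πi → indicator (toℕ (suc i) <? toℕ πi)) (lookup-extendFix i)) ⟩
    -- `suc a <? suc b` and `a <? b` have definitionally the same `does`
    ∑[ i ∈ allFin n ] indicator (toℕ i <? toℕ (lookup u i))
      ≡⟨ σ₂-as-∑ u ⟨
    + σ₂ u
      ∎)

  weight-extendFix : weight (extendFix u) ≡ weight u
  weight-extendFix =
    trans (weight-transfer {π = π} {u = u} extendFix-involution 0 σ₂-extendFix) (ℤ.*-identityˡ (weight u))

-- The involution of [n+2] exchanging 0 and j+1 and acting as u on the remaining n points,
-- which are relabelled through punchIn j and then shifted up by one.
extendSwap : {n : ℕ} → Fin (ℕ.suc n) → Vec (Fin n) n → Vec (Fin (ℕ.suc (ℕ.suc n))) (ℕ.suc (ℕ.suc n))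
extendSwap j u = suc j ∷ insertAt (Vec.map suc (Vec.map (punchIn j) u)) j zero

punchIn-<-⇔ : {n : ℕ} (j : Fin (ℕ.suc n)) (y z : Fin n) →
              toℕ (punchIn j y) ℕ.< toℕ (punchIn j z) ⇔ toℕ y ℕ.< toℕ z
punchIn-<-⇔ j y z = mk⇔
  (λ lt → ℕ.≰⇒> (λ z≤y → ℕ.<⇒≱ lt (Fin.punchIn-mono-≤ j z y z≤y)))
  (λ lt → ℕ.≰⇒> (λ pz≤py → ℕ.<⇒≱ lt (Fin.punchIn-cancel-≤ j z y pz≤py)))

module _ {n : ℕ} (j : Fin (ℕ.suc n)) (u : Vec (Fin n) n) where

  private
    π = extendSwap j u

    lookup-extendSwap-j : lookup π (suc j) ≡ zero
    lookup-extendSwap-j = Vec.insertAt-lookup _ j zero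

    lookup-extendSwap-punchIn : (y : Fin n) → lookup π (suc (punchIn j y)) ≡ suc (punchIn j (lookup u y))
    lookup-extendSwap-punchIn y = begin
      lookup π (suc (punchIn j y))                          ≡⟨ Vec.insertAt-punchIn _ j zero y ⟩
      lookup (Vec.map suc (Vec.map (punchIn j) u)) y        ≡⟨ Vec.lookup-map y suc (Vec.map (punchIn j) u) ⟩
      suc (lookup (Vec.map (punchIn j) u) y)                ≡⟨ cong suc (Vec.lookup-map y (punchIn j) u) ⟩
      suc (punchIn j (lookup u y))                          ∎

    π²-punchIn : (y : Fin n) → lookup π (lookup π (suc (punchIn j y))) ≡ suc (punchIn j (lookup u (lookup u y)))
    π²-punchIn y = trans (cong (lookup π) (lookup-extendSwap-punchIn y)) (lookup-extendSwap-punchIn (lookup u y))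

  extendSwap-involution : IsInvolution π ⇔ IsInvolution u
  extendSwap-involution = mk⇔ to from
    where
    to : IsInvolution π → IsInvolution u
    to inv y = Fin.punchIn-injective j _ _
                 (Fin.suc-injective (trans (sym (π²-punchIn y)) (inv (suc (punchIn j y)))))
    from : IsInvolution u → IsInvolution π
    from inv zero    = lookup-extendSwap-j
    from inv (suc x) with j Fin.≟ x
    ... | yes refl = cong (lookup π) lookup-extendSwap-j
    ... | no  j≢x  = subst (λ x → lookup π (lookup π (suc x)) ≡ suc x) (Fin.punchIn-punchOut j≢x)
                           (trans (π²-punchIn (punchOut j≢x)) (cong (suc ∘ punchIn j) (inv (punchOut j≢x))))

  σ₂-extendSwap : σ₂ π ≡ 1 ℕ.+ σ₂ u
  σ₂-extendSwap = ℤ.+-injective (begin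
    + σ₂ π
      ≡⟨ σ₂-as-∑ π ⟩
    ∑[ i ∈ allFin (ℕ.suc (ℕ.suc n)) ] opens i
      ≡⟨ ∑-allFin-suc (ℕ.suc n) opens ⟩
    + 1 + ∑[ i ∈ allFin (ℕ.suc n) ] opens (suc i)
      ≡⟨ cong (_+_ (+ 1)) (∑-allFin-punchIn n j (opens ∘ suc)) ⟩
    + 1 + (opens (suc j) + ∑[ y ∈ allFin n ] opens (suc (punchIn j y)))
      ≡⟨ cong (λ s → + 1 + s) (cong₂ _+_ opens-j (∑-cong (allFin n) opens-punchIn)) ⟩
    + 1 + (+ 0 + ∑[ y ∈ allFin n ] indicator (toℕ y <? toℕ (lookup u y)))
      ≡⟨ cong (_+_ (+ 1)) (trans (ℤ.+-identityˡ _) (sym (σ₂-as-∑ u))) ⟩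
    + 1 + + σ₂ u
      ≡⟨ ℤ.pos-+ 1 (σ₂ u) ⟨
    + (1 ℕ.+ σ₂ u)
      ∎)
    where
    opens : Fin (ℕ.suc (ℕ.suc n)) → ℤ
    opens i = indicator (toℕ i <? toℕ (lookup π i))
    opens-j : opens (suc j) ≡ + 0
    opens-j = cong (λ πj → indicator (toℕ (suc j) <? toℕ πj)) lookup-extendSwap-j
    opens-punchIn : (y : Fin n) → opens (suc (punchIn j y)) ≡ indicator (toℕ y <? toℕ (lookup u y))
    opens-punchIn y = begin
      opens (suc (punchIn j y))
        ≡⟨ cong (λ πi → indicator (toℕ (suc (punchIn j y)) <? toℕ πi)) (lookup-extendSwap-punchIn y) ⟩
      indicator (toℕ (punchIn j y) <? toℕ (punchIn j (lookup u y)))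
        ≡⟨ indicator-⇔ (punchIn-<-⇔ j y (lookup u y)) (toℕ (punchIn j y) <? toℕ (punchIn j (lookup u y)))
                                                      (toℕ y <? toℕ (lookup u y)) ⟩
      indicator (toℕ y <? toℕ (lookup u y))
        ∎

  weight-extendSwap : weight (extendSwap j u) ≡ - weight u
  weight-extendSwap = trans (weight-transfer {π = π} {u = u} extendSwap-involution 1 σ₂-extendSwap)
                            (ℤ.-1*i≡-i (weight u))

-- The recurrence t(n+2) = t(n+1) - (n+1) t(n)

∑-weight-fixing-zero : (n : ℕ) →
                       ∑[ v ∈ allMaps (ℕ.suc n) (ℕ.suc (ℕ.suc n)) ] weight (zero ∷ v) ≡ t (ℕ.suc n)
∑-weight-fixing-zero n = begin
  ∑[ v ∈ allMaps (ℕ.suc n) (ℕ.suc (ℕ.suc n)) ] weight (zero ∷ v)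
    ≡⟨ ∑-allMaps-punchIn (ℕ.suc n) (ℕ.suc n) zero (λ v → weight (zero ∷ v)) zero-hit ⟩
  ∑[ u ∈ allMaps (ℕ.suc n) (ℕ.suc n) ] weight (extendFix u)
    ≡⟨ ∑-cong (allMaps (ℕ.suc n) (ℕ.suc n)) weight-extendFix ⟩
  ∑ (allMaps (ℕ.suc n) (ℕ.suc n)) weight
    ≡⟨ t≡∑weight (ℕ.suc n) ⟨
  t (ℕ.suc n)
    ∎
  where
  zero-hit : ∀ v i → lookup v i ≡ zero → weight (zero ∷ v) ≡ + 0
  zero-hit v i vi≡0 = weight-collision {π = zero ∷ v} {i = zero} {j = suc i} (sym vi≡0) (λ ())

∑-weight-swapping-zero : (n : ℕ) (j : Fin (ℕ.suc n)) →
                         ∑[ v ∈ allMaps (ℕ.suc n) (ℕ.suc (ℕ.suc n)) ] weight (suc j ∷ v) ≡ - t n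
∑-weight-swapping-zero n j = begin
  ∑[ v ∈ allMaps (ℕ.suc n) N ] weight (suc j ∷ v)
    ≡⟨ ∑-allMaps-insertAt n N j (λ v → weight (suc j ∷ v)) ⟩
  ∑[ b ∈ allFin N ] ∑[ u ∈ allMaps n N ] weight (suc j ∷ insertAt u j b)
    ≡⟨ ∑-allFin-suc (ℕ.suc n) (λ b → ∑[ u ∈ allMaps n N ] weight (suc j ∷ insertAt u j b)) ⟩
  ∑[ u ∈ allMaps n N ] weight (suc j ∷ insertAt u j zero)
    + ∑[ b ∈ allFin (ℕ.suc n) ] ∑[ u ∈ allMaps n N ] weight (suc j ∷ insertAt u j (suc b))
    ≡⟨ cong (_+_ (∑[ u ∈ allMaps n N ] weight (suc j ∷ insertAt u j zero))) image-nonzero-vanishes ⟩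
  ∑[ u ∈ allMaps n N ] weight (suc j ∷ insertAt u j zero) + + 0
    ≡⟨ ℤ.+-identityʳ _ ⟩
  ∑[ u ∈ allMaps n N ] weight (suc j ∷ insertAt u j zero)
    ≡⟨ ∑-allMaps-punchIn n (ℕ.suc n) zero (λ u → weight (suc j ∷ insertAt u j zero)) zero-hit ⟩
  ∑[ u ∈ allMaps n (ℕ.suc n) ] weight (suc j ∷ insertAt (Vec.map suc u) j zero)
    ≡⟨ ∑-allMaps-punchIn n n j (λ u → weight (suc j ∷ insertAt (Vec.map suc u) j zero)) j-hit ⟩
  ∑[ u ∈ allMaps n n ] weight (extendSwap j u)
    ≡⟨ ∑-cong (allMaps n n) (weight-extendSwap j) ⟩
  ∑[ u ∈ allMaps n n ] - weight u
    ≡⟨ ∑-neg (allMaps n n) weight ⟩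
  - ∑ (allMaps n n) weight
    ≡⟨ cong -_ (t≡∑weight n) ⟨
  - t n
    ∎
  where
  N = ℕ.suc (ℕ.suc n)
  image-nonzero : ∀ b u → weight (suc j ∷ insertAt u j (suc b)) ≡ + 0
  image-nonzero b u = weight-nonInvolution {π = suc j ∷ insertAt u j (suc b)}
    (λ inv → 0≢suc (trans (sym (inv zero)) (Vec.insertAt-lookup u j (suc b))))
    where 0≢suc : zero ≢ suc b
          0≢suc ()
  image-nonzero-vanishes :
    ∑[ b ∈ allFin (ℕ.suc n) ] ∑[ u ∈ allMaps n N ] weight (suc j ∷ insertAt u j (suc b)) ≡ + 0
  image-nonzero-vanishes = begin
    ∑[ b ∈ allFin (ℕ.suc n) ] ∑[ u ∈ allMaps n N ] weight (suc j ∷ insertAt u j (suc b))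
      ≡⟨ ∑-cong (allFin (ℕ.suc n)) (λ b → ∑-cong (allMaps n N) (image-nonzero b)) ⟩
    ∑[ b ∈ allFin (ℕ.suc n) ] ∑[ u ∈ allMaps n N ] + 0
      ≡⟨ ∑-cong (allFin (ℕ.suc n)) (λ _ → ∑-zero (allMaps n N)) ⟩
    ∑[ b ∈ allFin (ℕ.suc n) ] + 0
      ≡⟨ ∑-zero (allFin (ℕ.suc n)) ⟩
    + 0
      ∎
  zero-hit : ∀ u i → lookup u i ≡ zero → weight (suc j ∷ insertAt u j zero) ≡ + 0
  zero-hit u i ui≡0 = weight-collision {π = suc j ∷ insertAt u j zero} {i = suc j} {j = suc (punchIn j i)}
    (trans (Vec.insertAt-lookup u j zero) (sym (trans (Vec.insertAt-punchIn u j zero i) ui≡0)))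
    (Fin.punchInᵢ≢i j i ∘ sym ∘ Fin.suc-injective)
  j-hit : ∀ u i → lookup u i ≡ j → weight (suc j ∷ insertAt (Vec.map suc u) j zero) ≡ + 0
  j-hit u i ui≡j =
    weight-collision {π = suc j ∷ insertAt (Vec.map suc u) j zero} {i = zero} {j = suc (punchIn j i)}
    (sym (trans (Vec.insertAt-punchIn _ j zero i) (trans (Vec.lookup-map i suc u) (cong suc ui≡j))))
    (λ ())

t-recurrence : (n : ℕ) → t (ℕ.suc (ℕ.suc n)) ≡ t (ℕ.suc n) - + ℕ.suc n * t n
t-recurrence n = begin
  t (ℕ.suc (ℕ.suc n))
    ≡⟨ t≡∑weight (ℕ.suc (ℕ.suc n)) ⟩
  ∑ (allMaps (ℕ.suc (ℕ.suc n)) (ℕ.suc (ℕ.suc n))) weight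
    ≡⟨ ∑-allMaps-head (ℕ.suc n) (ℕ.suc (ℕ.suc n)) weight ⟩
  ∑[ a ∈ allFin (ℕ.suc (ℕ.suc n)) ] ∑[ v ∈ allMaps (ℕ.suc n) (ℕ.suc (ℕ.suc n)) ] weight (a ∷ v)
    ≡⟨ ∑-allFin-suc (ℕ.suc n) (λ a → ∑[ v ∈ allMaps (ℕ.suc n) (ℕ.suc (ℕ.suc n)) ] weight (a ∷ v)) ⟩
  ∑[ v ∈ allMaps (ℕ.suc n) (ℕ.suc (ℕ.suc n)) ] weight (zero ∷ v)
    + ∑[ j ∈ allFin (ℕ.suc n) ] ∑[ v ∈ allMaps (ℕ.suc n) (ℕ.suc (ℕ.suc n)) ] weight (suc j ∷ v)
    ≡⟨ cong₂ _+_ (∑-weight-fixing-zero n) (∑-cong (allFin (ℕ.suc n)) (∑-weight-swapping-zero n)) ⟩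
  t (ℕ.suc n) + ∑[ j ∈ allFin (ℕ.suc n) ] - t n
    ≡⟨ cong (_+_ (t (ℕ.suc n)))
            (trans (∑-allFin-const (ℕ.suc n) (- t n)) (sym (ℤ.neg-distribʳ-* (+ ℕ.suc n) (t n)))) ⟩
  t (ℕ.suc n) - + ℕ.suc n * t n
    ∎

-- Odd numbers and 2-adic orders

Odd : ℤ → Set
Odd x = ∃[ q ] x ≡ + 2 * q + + 1

odd-* : {x y : ℤ} → Odd x → Odd y → Odd (x * y)
odd-* (q , refl) (r , refl) = + 2 * q * r + q + r , expand q r
  where
  expand : ∀ q r → (+ 2 * q + + 1) * (+ 2 * r + + 1) ≡ + 2 * (+ 2 * q * r + q + r) + + 1
  expand = solve-∀

odd-neg : {x : ℤ} → Odd x → Odd (- x)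
odd-neg (q , refl) = - q - + 1 , expand q
  where
  expand : ∀ q → - (+ 2 * q + + 1) ≡ + 2 * (- q - + 1) + + 1
  expand = solve-∀

odd-2*+ : (c : ℤ) {x : ℤ} → Odd x → Odd (+ 2 * c + x)
odd-2*+ c (q , refl) = c + q , expand c q
  where
  expand : ∀ c q → + 2 * c + (+ 2 * q + + 1) ≡ + 2 * (c + q) + + 1
  expand = solve-∀

odd⇒¬2∣ : {x : ℤ} → Odd x → ¬ (+ 2 ∣ℤ x)
odd⇒¬2∣ (q , refl) 2∣x = ℕ.1+n≰n (ℕ.∣⇒≤ (Signed.∣⇒∣ᵤ 2∣1))
  where
  2∣1 : + 2 Signed.∣ + 1
  2∣1 = Signed.∣m+n∣m⇒∣n (Signed.∣ᵤ⇒∣ 2∣x) (Signed.∣m⇒∣m*n q Signed.∣-refl)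

¬2∣⇒odd : (m : ℕ) → ¬ (2 ∣ m) → Odd (+ m)
¬2∣⇒odd 0                 ¬2∣m = ⊥-elim (¬2∣m (2 ℕ.∣0))
¬2∣⇒odd 1                 ¬2∣m = + 0 , refl
¬2∣⇒odd (ℕ.suc (ℕ.suc m)) ¬2∣m =
  subst Odd (sym (ℤ.pos-+ 2 m)) (odd-2*+ (+ 1) (¬2∣⇒odd m (¬2∣m ∘ ℕ.∣m∣n⇒∣m+n ℕ.∣-refl)))

^-monoʳ-∣ : (a : ℕ) {m n : ℕ} → m ≤ n → a ^ m ∣ a ^ n
^-monoʳ-∣ a {m} {n} m≤n = divides (a ^ (n ℕ.∸ m)) (begin
  a ^ n                       ≡⟨ cong (a ^_) (ℕ.m+[n∸m]≡n m≤n) ⟨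
  a ^ (m ℕ.+ (n ℕ.∸ m))       ≡⟨ ℕ.^-distribˡ-+-* a m (n ℕ.∸ m) ⟩
  a ^ m ℕ.* a ^ (n ℕ.∸ m)     ≡⟨ ℕ.*-comm (a ^ m) _ ⟩
  a ^ (n ℕ.∸ m) ℕ.* a ^ m     ∎)

ord₂-pow*odd : (e : ℕ) {x : ℤ} → Odd x → Ord₂ (+ (2 ^ e) * x) (fin e)
ord₂-pow*odd e {x} x-odd = Signed.∣⇒∣ᵤ (Signed.∣m⇒∣m*n x (Signed.∣-refl {+ (2 ^ e)})) , maximal
  where
  maximal : (f : ℕ) → + (2 ^ f) ∣ℤ + (2 ^ e) * x → f ≤ e
  maximal f 2^f∣ with f ≤? e
  ... | yes f≤e = f≤e
  ... | no  f≰e = ⊥-elim (odd⇒¬2∣ x-odd (ℕ.*-cancelˡ-∣ (2 ^ e) {{ℕ.m^n≢0 2 e}} 2^e*2∣))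
    where
    2^e*2∣ : 2 ^ e ℕ.* 2 ∣ 2 ^ e ℕ.* ∣ x ∣
    2^e*2∣ = subst₂ _∣_ (ℕ.*-comm 2 (2 ^ e)) (ℤ.abs-* (+ (2 ^ e)) x)
                    (ℕ.∣-trans (^-monoʳ-∣ 2 (ℕ.≰⇒> f≰e)) 2^f∣)

ord₂-≡pow*odd : (e : ℕ) {x z : ℤ} → Odd x → z ≡ + (2 ^ e) * x → Ord₂ z (fin e)
ord₂-≡pow*odd e x-odd refl = ord₂-pow*odd e x-odd

ord₂-oddPart : {k e : ℕ} → Ord₂ (+ k) (fin e) → ∃[ m ] k ≡ m ℕ.* 2 ^ e × Odd (+ m)
ord₂-oddPart {k} {e} (divides m k≡m*2^e , maximal) = m , k≡m*2^e , ¬2∣⇒odd m ¬2∣m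
  where
  ¬2∣m : ¬ (2 ∣ m)
  ¬2∣m 2∣m =
    ℕ.1+n≰n (maximal (ℕ.suc e) (subst (2 ^ ℕ.suc e ∣_) (sym k≡m*2^e) (ℕ.*-monoˡ-∣ (2 ^ e) 2∣m)))

-- One period of the recurrence

t₄ : ℕ → ℕ → ℤ
t₄ k i = t (4 ℕ.* k ℕ.+ i)

t₄-recurrence : (k i : ℕ) → t₄ k (2 ℕ.+ i) ≡ t₄ k (1 ℕ.+ i) - (+ 4 * + k + + (1 ℕ.+ i)) * t₄ k i
t₄-recurrence k i = begin
  t (4k ℕ.+ (2 ℕ.+ i))
    ≡⟨ cong t (trans (ℕ.+-suc 4k (1 ℕ.+ i)) (cong ℕ.suc (ℕ.+-suc 4k i))) ⟩
  t (2 ℕ.+ (4k ℕ.+ i))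
    ≡⟨ t-recurrence (4k ℕ.+ i) ⟩
  t (1 ℕ.+ (4k ℕ.+ i)) - + (1 ℕ.+ (4k ℕ.+ i)) * t (4k ℕ.+ i)
    ≡⟨ cong₂ (λ n c → t n - c * t (4k ℕ.+ i)) (sym (ℕ.+-suc 4k i)) coefficient ⟩
  t (4k ℕ.+ (1 ℕ.+ i)) - (+ 4 * + k + + (1 ℕ.+ i)) * t (4k ℕ.+ i)
    ∎
  where
  4k = 4 ℕ.* k
  coefficient : + (1 ℕ.+ (4k ℕ.+ i)) ≡ + 4 * + k + + (1 ℕ.+ i)
  coefficient = begin
    + (1 ℕ.+ (4k ℕ.+ i))         ≡⟨ cong +_ (ℕ.+-suc 4k i) ⟨
    + (4k ℕ.+ (1 ℕ.+ i))         ≡⟨ ℤ.pos-+ 4k (1 ℕ.+ i) ⟩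
    + 4k + + (1 ℕ.+ i)           ≡⟨ cong (_+ + (1 ℕ.+ i)) (ℤ.pos-* 4 k) ⟩
    + 4 * + k + + (1 ℕ.+ i)      ∎

record TwoAdicForm (k : ℕ) : Set where
  field
    X Y   : ℤ
    X-odd : Odd X
    Y-odd : Odd Y
    t₄-0  : t₄ k 0 ≡ + (2 ^ k) * X
    t₄-2  : t₄ k 2 ≡ + (2 ^ k) * (+ 8 * + k * Y)

module TwoAdicFormConsequences {k : ℕ} (form : TwoAdicForm k) where

  open TwoAdicForm form

  private
    K = + k
    P = + (2 ^ k)

    2P≡2^[1+k] : + 2 * P ≡ + (2 ^ ℕ.suc k)
    2P≡2^[1+k] = sym (ℤ.pos-* 2 (2 ^ k))

  X₁ X₃ X₄ Y₆ : ℤ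
  X₁ = + 2 * (+ 4 * K * Y) + (+ 4 * K + + 1) * X
  X₃ = - ((+ 4 * K + + 1) * (+ 2 * (+ 2 * K * Y) + (+ 2 * K + + 1) * X))
  X₄ = - ((+ 2 * K + + 1) * (+ 2 * (+ 8 * K * Y) + (+ 4 * K + + 1) * X))
  Y₆ = + 2 * (K * (+ 12 * K + + 5) * Y) + (+ 2 * K + + 1) * (+ 4 * K + + 1) * X

  odd-2K+1 : Odd (+ 2 * K + + 1)
  odd-2K+1 = K , refl

  odd-4K+1 : Odd (+ 4 * K + + 1)
  odd-4K+1 = + 2 * K , regroup K
    where
    regroup : ∀ K → + 4 * K + + 1 ≡ + 2 * (+ 2 * K) + + 1
    regroup = solve-∀

  t₄-1 : t₄ k 1 ≡ P * X₁
  t₄-1 = begin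
    t₄ k 1
      ≡⟨ sub-add (t₄ k 1) ((+ 4 * K + + 1) * t₄ k 0) ⟩
    t₄ k 1 - (+ 4 * K + + 1) * t₄ k 0 + (+ 4 * K + + 1) * t₄ k 0
      ≡⟨ cong (_+ (+ 4 * K + + 1) * t₄ k 0) (t₄-recurrence k 0) ⟨
    t₄ k 2 + (+ 4 * K + + 1) * t₄ k 0
      ≡⟨ cong₂ (λ a b → a + (+ 4 * K + + 1) * b) t₄-2 t₄-0 ⟩
    P * (+ 8 * K * Y) + (+ 4 * K + + 1) * (P * X)
      ≡⟨ poly K P X Y ⟩
    P * X₁
      ∎
    where
    sub-add : ∀ a b → a ≡ a - b + b
    sub-add = solve-∀
    poly : ∀ K P X Y → P * (+ 8 * K * Y) + (+ 4 * K + + 1) * (P * X)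
                       ≡ P * (+ 2 * (+ 4 * K * Y) + (+ 4 * K + + 1) * X)
    poly = solve-∀

  t₄-3 : t₄ k 3 ≡ + 2 * P * X₃
  t₄-3 = begin
    t₄ k 3
      ≡⟨ t₄-recurrence k 1 ⟩
    t₄ k 2 - (+ 4 * K + + 2) * t₄ k 1
      ≡⟨ cong₂ (λ a b → a - (+ 4 * K + + 2) * b) t₄-2 t₄-1 ⟩
    P * (+ 8 * K * Y) - (+ 4 * K + + 2) * (P * X₁)
      ≡⟨ poly K P X Y ⟩
    + 2 * P * X₃
      ∎
    where
    poly : ∀ K P X Y →
           P * (+ 8 * K * Y) - (+ 4 * K + + 2) * (P * (+ 2 * (+ 4 * K * Y) + (+ 4 * K + + 1) * X))
           ≡ + 2 * P * - ((+ 4 * K + + 1) * (+ 2 * (+ 2 * K * Y) + (+ 2 * K + + 1) * X))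
    poly = solve-∀

  t₄-4 : t₄ k 4 ≡ + 2 * P * X₄
  t₄-4 = begin
    t₄ k 4
      ≡⟨ t₄-recurrence k 2 ⟩
    t₄ k 3 - (+ 4 * K + + 3) * t₄ k 2
      ≡⟨ cong₂ (λ a b → a - (+ 4 * K + + 3) * b) t₄-3 t₄-2 ⟩
    + 2 * P * X₃ - (+ 4 * K + + 3) * (P * (+ 8 * K * Y))
      ≡⟨ poly K P X Y ⟩
    + 2 * P * X₄
      ∎
    where
    poly : ∀ K P X Y →
           + 2 * P * - ((+ 4 * K + + 1) * (+ 2 * (+ 2 * K * Y) + (+ 2 * K + + 1) * X))
             - (+ 4 * K + + 3) * (P * (+ 8 * K * Y))
           ≡ + 2 * P * - ((+ 2 * K + + 1) * (+ 2 * (+ 8 * K * Y) + (+ 4 * K + + 1) * X))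
    poly = solve-∀

  t₄-6 : t₄ k 6 ≡ + 2 * P * (+ 8 * (+ 1 + K) * Y₆)
  t₄-6 = begin
    t₄ k 6
      ≡⟨ t₄-recurrence k 4 ⟩
    t₄ k 5 - (+ 4 * K + + 5) * t₄ k 4
      ≡⟨ cong (_- (+ 4 * K + + 5) * t₄ k 4) (t₄-recurrence k 3) ⟩
    t₄ k 4 - (+ 4 * K + + 4) * t₄ k 3 - (+ 4 * K + + 5) * t₄ k 4
      ≡⟨ cong₂ (λ a b → a - (+ 4 * K + + 4) * b - (+ 4 * K + + 5) * a) t₄-4 t₄-3 ⟩
    + 2 * P * X₄ - (+ 4 * K + + 4) * (+ 2 * P * X₃) - (+ 4 * K + + 5) * (+ 2 * P * X₄)
      ≡⟨ poly K P X Y ⟩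
    + 2 * P * (+ 8 * (+ 1 + K) * Y₆)
      ∎
    where
    poly : ∀ K P X Y →
           + 2 * P * - ((+ 2 * K + + 1) * (+ 2 * (+ 8 * K * Y) + (+ 4 * K + + 1) * X))
             - (+ 4 * K + + 4) * (+ 2 * P * - ((+ 4 * K + + 1) * (+ 2 * (+ 2 * K * Y) + (+ 2 * K + + 1) * X)))
             - (+ 4 * K + + 5) * (+ 2 * P * - ((+ 2 * K + + 1) * (+ 2 * (+ 8 * K * Y) + (+ 4 * K + + 1) * X)))
           ≡ + 2 * P * (+ 8 * (+ 1 + K) * (+ 2 * (K * (+ 12 * K + + 5) * Y) + (+ 2 * K + + 1) * (+ 4 * K + + 1) * X))
    poly = solve-∀

  ord₂-t₄-1 : Ord₂ (t₄ k 1) (fin k)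
  ord₂-t₄-1 = ord₂-≡pow*odd k (odd-2*+ (+ 4 * K * Y) (odd-* odd-4K+1 X-odd)) t₄-1

  ord₂-t₄-3 : Ord₂ (t₄ k 3) (fin (ℕ.suc k))
  ord₂-t₄-3 = ord₂-≡pow*odd (ℕ.suc k)
    (odd-neg (odd-* odd-4K+1 (odd-2*+ (+ 2 * K * Y) (odd-* odd-2K+1 X-odd))))
    (trans t₄-3 (cong (_* X₃) 2P≡2^[1+k]))

  next : TwoAdicForm (ℕ.suc k)
  next = record
    { X     = X₄
    ; Y     = Y₆
    ; X-odd = odd-neg (odd-* odd-2K+1 (odd-2*+ (+ 8 * K * Y) (odd-* odd-4K+1 X-odd)))
    ; Y-odd = odd-2*+ (K * (+ 12 * K + + 5) * Y) (odd-* (odd-* odd-2K+1 odd-4K+1) X-odd)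
    ; t₄-0  = trans (cong t (shift k 0)) (trans t₄-4 (cong (_* X₄) 2P≡2^[1+k]))
    ; t₄-2  = trans (cong t (shift k 2))
                    (trans t₄-6 (cong₂ (λ p c → p * (+ 8 * c * Y₆)) 2P≡2^[1+k] (sym (ℤ.pos-+ 1 k))))
    }
    where
    shift : ∀ k i → 4 ℕ.* (1 ℕ.+ k) ℕ.+ i ≡ 4 ℕ.* k ℕ.+ (4 ℕ.+ i)
    shift = ℕ-Solver.solve-∀

twoAdicForm : (k : ℕ) → TwoAdicForm k
twoAdicForm ℕ.zero    =
  record { X = + 1 ; Y = + 1 ; X-odd = + 0 , refl ; Y-odd = + 0 , refl ; t₄-0 = refl ; t₄-2 = refl }
twoAdicForm (ℕ.suc k) = TwoAdicFormConsequences.next (twoAdicForm k)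

ord₂-t₄-0 : (k : ℕ) → Ord₂ (t₄ k 0) (fin k)
ord₂-t₄-0 k = ord₂-≡pow*odd k X-odd t₄-0
  where open TwoAdicForm (twoAdicForm k)

ord₂-t₄-1 : (k : ℕ) → Ord₂ (t₄ k 1) (fin k)
ord₂-t₄-1 k = TwoAdicFormConsequences.ord₂-t₄-1 (twoAdicForm k)

ord₂-t₄-3 : (k : ℕ) → Ord₂ (t₄ k 3) (fin (ℕ.suc k))
ord₂-t₄-3 k = TwoAdicFormConsequences.ord₂-t₄-3 (twoAdicForm k)

ord₂-t₄-2 : (k : ℕ) (e : ℕ∞) → Ord₂ (+ k) e → Ord₂ (t₄ k 2) (fin (k ℕ.+ 3) +∞ e)
ord₂-t₄-2 .0 ∞       refl = refl
ord₂-t₄-2 k  (fin e) ord₂k with ord₂-oddPart ord₂k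
... | m , k≡m*2^e , m-odd = ord₂-≡pow*odd (k ℕ.+ 3 ℕ.+ e) (odd-* m-odd Y-odd) (begin
  t₄ k 2                                     ≡⟨ t₄-2 ⟩
  + (2 ^ k) * (+ 8 * + k * Y)                ≡⟨ cong (λ n → + (2 ^ k) * (+ 8 * + n * Y)) k≡m*2^e ⟩
  + (2 ^ k) * (+ 8 * + (m ℕ.* 2 ^ e) * Y)    ≡⟨ cong (λ n → + (2 ^ k) * (+ 8 * n * Y)) (ℤ.pos-* m (2 ^ e)) ⟩
  + (2 ^ k) * (+ 8 * (+ m * + (2 ^ e)) * Y)  ≡⟨ regroup (+ (2 ^ k)) (+ (2 ^ e)) (+ m) Y ⟩
  + (2 ^ k) * + 8 * + (2 ^ e) * (+ m * Y)    ≡⟨ cong (_* (+ m * Y)) pow ⟨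
  + (2 ^ (k ℕ.+ 3 ℕ.+ e)) * (+ m * Y)        ∎)
  where
  open TwoAdicForm (twoAdicForm k)
  regroup : ∀ A B M Y → A * (+ 8 * (M * B) * Y) ≡ A * + 8 * B * (M * Y)
  regroup = solve-∀
  pow : + (2 ^ (k ℕ.+ 3 ℕ.+ e)) ≡ + (2 ^ k) * + 8 * + (2 ^ e)
  pow = begin
    + (2 ^ (k ℕ.+ 3 ℕ.+ e))              ≡⟨ cong +_ (ℕ.^-distribˡ-+-* 2 (k ℕ.+ 3) e) ⟩
    + (2 ^ (k ℕ.+ 3) ℕ.* 2 ^ e)          ≡⟨ cong (λ n → + (n ℕ.* 2 ^ e)) (ℕ.^-distribˡ-+-* 2 k 3) ⟩
    + (2 ^ k ℕ.* 8 ℕ.* 2 ^ e)            ≡⟨ ℤ.pos-* (2 ^ k ℕ.* 8) (2 ^ e) ⟩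
    + (2 ^ k ℕ.* 8) * + (2 ^ e)          ≡⟨ cong (_* + (2 ^ e)) (ℤ.pos-* (2 ^ k) 8) ⟩
    + (2 ^ k) * + 8 * + (2 ^ e)          ∎

theorem5p2 : (k r : ℕ) → r ℕ.< 4 →
    (r ≢ 2 → Ord₂ (t (4 ℕ.* k ℕ.+ r)) (fin (k ℕ.+ r ℕ./ 2)))
    × (r ≡ 2 → (e : ℕ∞) → Ord₂ (+ k) e → Ord₂ (t (4 ℕ.* k ℕ.+ r)) (fin (k ℕ.+ 3) +∞ e))
theorem5p2 k 0 _ = (λ _ → subst (Ord₂ (t₄ k 0) ∘ fin) (sym (ℕ.+-identityʳ k)) (ord₂-t₄-0 k)) , λ ()
theorem5p2 k 1 _ = (λ _ → subst (Ord₂ (t₄ k 1) ∘ fin) (sym (ℕ.+-identityʳ k)) (ord₂-t₄-1 k)) , λ ()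
theorem5p2 k 2 _ = (λ 2≢2 → ⊥-elim (2≢2 refl)) , λ _ → ord₂-t₄-2 k
theorem5p2 k 3 _ = (λ _ → subst (Ord₂ (t₄ k 3) ∘ fin) (ℕ.+-comm 1 k) (ord₂-t₄-3 k)) , λ ()
theorem5p2 k (ℕ.suc (ℕ.suc (ℕ.suc (ℕ.suc _)))) (s≤s (s≤s (s≤s (s≤s ()))))
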